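{- Let $(P_n)_{n\ge0}$ and $(Q_n)_{n\ge0}$ be the sequences of polynomials in $m$ defined by $P_0=Q_0=0$, $P_1(m)=Q_1(m)=m$, and for $n\ge 1$: $Q_{n+1}(m)=\sum_{k=0}^{n}Q_{n-k}(m)\,P_k(m)$ and $P_{n+1}(m)=P_n(m+1)+Q_{n+1}(m)$. For $i\ge 0$ let $\bar\psi_{2i+1}$ be the coefficient of $m^{i}$ in $Q_{2i+1}$. Then, as formal power series, $$\sum_{i\ge 0}\bar\psi_{2i+1}z^i=\frac{z^2}{(1-4z)\sqrt{1-4z}}.$$
   Context: $P_n(m)$ counts beta-normal untyped lambda terms of size $n$ with de Bruijn indices in $\{1,\dots,m\}$, and $Q_n(m)$ counts those not starting with a $\lambda$. -}

module Defs where

open import Data.Nat using (ℕ; zero; suc; _+_; _*_; _∸_; _^_)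
open import Data.Nat.Combinatorics using (_C_)
open import Data.List using (List; []; _∷_; _++_; reverse; map; zipWith; foldr)
open import Data.Product using (_×_; _,_; proj₁; proj₂)

-- Polynomials in m with natural-number coefficients, as coefficient
-- lists [a₀, a₁, …] (lowest degree first).  Trailing zeros are allowed;
-- only the coefficient function `coeff` is ever observed.

Poly : Set
Poly = List ℕ

infixl 6 _⊕_
infixl 7 _⊗_

_⊕_ : Poly → Poly → Poly
[]       ⊕ q        = q
(a ∷ p)  ⊕ []       = a ∷ p
(a ∷ p)  ⊕ (b ∷ q)  = (a + b) ∷ (p ⊕ q)

scale : ℕ → Poly → Poly
scale c = map (c *_)

_⊗_ : Poly → Poly → Poly
[]      ⊗ q = []
(a ∷ p) ⊗ q = scale a q ⊕ (0 ∷ (p ⊗ q))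

varM : Poly
varM = 0 ∷ 1 ∷ []

-- p ↦ p(m+1)  (Horner: a + m·p' ↦ a + (m+1)·p'(m+1))
shift : Poly → Poly
shift []      = []
shift (a ∷ p) = (a ∷ []) ⊕ ((1 ∷ 1 ∷ []) ⊗ shift p)

coeff : Poly → ℕ → ℕ
coeff []      _       = 0
coeff (a ∷ p) zero    = a
coeff (a ∷ p) (suc i) = coeff p i

polySum : List Poly → Poly
polySum = foldr _⊕_ []

-- The sequences P_n, Q_n.
-- table n = [(P_0,Q_0), (P_1,Q_1), …, (P_n,Q_n)]

lastPair : List (Poly × Poly) → Poly × Poly
lastPair []            = ([] , [])
lastPair (x ∷ [])      = x
lastPair (x ∷ y ∷ xs)  = lastPair (y ∷ xs)

-- given [(P_0,Q_0),…,(P_n,Q_n)] with n ≥ 1, compute (P_{n+1}, Q_{n+1}):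
--   Q_{n+1} = Σ_{k=0}^{n} Q_{n-k} P_k,   P_{n+1} = P_n(m+1) + Q_{n+1}
nextPair : List (Poly × Poly) → Poly × Poly
nextPair L = (shift (proj₁ (lastPair L)) ⊕ Qn1 , Qn1)
  where
  Ps = map proj₁ L
  Qs = map proj₂ L
  Qn1 = polySum (zipWith _⊗_ (reverse Qs) Ps)

table : ℕ → List (Poly × Poly)
table zero          = ([] , []) ∷ []
table (suc zero)    = ([] , []) ∷ (varM , varM) ∷ []
table (suc (suc n)) = table (suc n) ++ (nextPair (table (suc n)) ∷ [])

P : ℕ → Poly
P n = proj₁ (lastPair (table n))

Q : ℕ → Poly
Q n = proj₂ (lastPair (table n))

ψ̄ : ℕ → ℕ
ψ̄ i = coeff (Q (suc (2 * i))) i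

Series : Set
Series = ℕ → ℕ

sumUpTo : ℕ → (ℕ → ℕ) → ℕ
sumUpTo zero    f = f 0
sumUpTo (suc n) f = sumUpTo n f + f (suc n)

infixl 7 _⋆_
_⋆_ : Series → Series → Series
(f ⋆ g) n = sumUpTo n (λ k → f k * g (n ∸ k))

zSquared : Series
zSquared (suc (suc zero)) = 1
zSquared _                = 0

-- 1/(1-4z) = Σ 4^k z^k
inv1m4z : Series
inv1m4z k = 4 ^ k

-- 1/√(1-4z) = Σ C(2k,k) z^k
invSqrt1m4z : Series
invSqrt1m4z k = (2 * k) C k

rhsSeries : Series
rhsSeries = zSquared ⋆ (inv1m4z ⋆ invSqrt1m4z)

-- Write [m^j] for the coefficient of m^j. By induction deg P_n, deg Q_n ≤ ⌈n/2⌉, so in the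
-- convolution defining Q_{n+1} only the two top diagonals of the coefficient triangle interact.
-- Put c_i = [m^{i+1}] Q_{2i+1}, u_i = [m^i] Q_{2i}, w_i = [m^i] P_{2i}, v_i = [m^i] Q_{2i+1} = ψ̄_{2i+1}
-- and y_i = [m^i] P_{2i+1}. Since p(m) ↦ p(m+1) preserves degree and top coefficient, the
-- generating series satisfy
--   c = 1 + z c²,  w = z c + u,  u = z (w c + c u),  v = w u + z (c v + y c),  y = w + v.
-- Each of these equations determines its solution coefficient by coefficient. With
-- b = Σ C(2k,k) z^k, whose square is Σ 4^k z^k by the classical convolution identity, both b and
-- 1 + 2 z c b solve (X − 2 z c b)² = 1 (use b² = 1 + 4 z b² and c = 1 + z c²), hence are equal;
-- then z b solves the equation for w and z² b³ the one for v.

module Submission where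

open import Defs
open import Data.Nat
open import Data.Nat.Properties
open import Data.Nat.Induction using (<-rec)
open import Data.Nat.Combinatorics using (_C_; nCk+nC[k+1]≡[n+1]C[k+1]; k>n⇒nCk≡0; nCk≡nC[n∸k])
open import Data.Nat.ListAction using (sum)
open import Data.Nat.ListAction.Properties using (sum-++)
open import Data.Nat.Tactic.RingSolver using (solve-∀)
open import Data.List using ([]; _∷_; _∷ʳ_; reverse; map; zipWith; upTo)
open import Data.List.Properties using (map-++; map-∘; reverse-++; reverse-map; upTo-∷ʳ; map-upTo)
open import Data.Product using (_×_; _,_; proj₁; proj₂)
open import Function using (_∘_)
open import Level using (0ℓ)
open import Algebra.Bundles using (CommutativeSemiring)
open import Algebra.Structures.Biased using (IsCommutativeSemiringˡ)
open import Algebra.Properties.CommutativeSemigroup +-commutativeSemigroup using (interchange; xy∙z≈xz∙y)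
open import Algebra.Properties.CommutativeSemigroup *-commutativeSemigroup using (x∙yz≈y∙xz)
import Algebra.Solver.Ring.NaturalCoefficients.Default as SemiringSolver
open import Relation.Binary.Structures using (IsEquivalence)
import Relation.Binary.Reasoning.Setoid as SetoidReasoning
open import Relation.Binary.PropositionalEquality

-- Coefficients and degrees of polynomials

coeff-⊕ : ∀ p q j → coeff (p ⊕ q) j ≡ coeff p j + coeff q j
coeff-⊕ []      q       j       = refl
coeff-⊕ (a ∷ p) []      j       = sym (+-identityʳ _)
coeff-⊕ (a ∷ p) (b ∷ q) zero    = refl
coeff-⊕ (a ∷ p) (b ∷ q) (suc j) = coeff-⊕ p q j

coeff-scale : ∀ c p j → coeff (scale c p) j ≡ c * coeff p j
coeff-scale c []      j       = sym (*-zeroʳ c)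
coeff-scale c (a ∷ p) zero    = refl
coeff-scale c (a ∷ p) (suc j) = coeff-scale c p j

coeff-⊗-zero : ∀ a p q → coeff ((a ∷ p) ⊗ q) zero ≡ a * coeff q 0
coeff-⊗-zero a p q = begin
  coeff (scale a q ⊕ (0 ∷ p ⊗ q)) 0 ≡⟨ coeff-⊕ (scale a q) (0 ∷ p ⊗ q) 0 ⟩
  coeff (scale a q) 0 + 0            ≡⟨ +-identityʳ _ ⟩
  coeff (scale a q) 0                ≡⟨ coeff-scale a q 0 ⟩
  a * coeff q 0                      ∎
  where open ≡-Reasoning

coeff-⊗-suc : ∀ a p q j → coeff ((a ∷ p) ⊗ q) (suc j) ≡ a * coeff q (suc j) + coeff (p ⊗ q) j
coeff-⊗-suc a p q j = trans (coeff-⊕ (scale a q) (0 ∷ p ⊗ q) (suc j))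
  (cong (_+ coeff (p ⊗ q) j) (coeff-scale a q (suc j)))

-- A record rather than a function type, so that d and p are inferred from its proofs.
record DegreeBelow (d : ℕ) (p : Poly) : Set where
  constructor degreeBelow
  field vanishes : ∀ j → d ≤ j → coeff p j ≡ 0
open DegreeBelow

DegreeBelow-tail : ∀ {d c p} → DegreeBelow (suc d) (c ∷ p) → DegreeBelow d p
vanishes (DegreeBelow-tail h) j d≤j = vanishes h (suc j) (s≤s d≤j)

DegreeBelow-mono : ∀ {d e p} → d ≤ e → DegreeBelow d p → DegreeBelow e p
vanishes (DegreeBelow-mono d≤e h) j e≤j = vanishes h j (≤-trans d≤e e≤j)

DegreeBelow0-⊗ˡ : ∀ p q → DegreeBelow 0 p → DegreeBelow 0 (p ⊗ q)
vanishes (DegreeBelow0-⊗ˡ []      q h) j       _ = refl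
vanishes (DegreeBelow0-⊗ˡ (a ∷ p) q h) zero    _
  rewrite coeff-⊗-zero a p q | vanishes h 0 z≤n = refl
vanishes (DegreeBelow0-⊗ˡ (a ∷ p) q h) (suc j) _
  rewrite coeff-⊗-suc a p q j | vanishes h 0 z≤n =
  vanishes (DegreeBelow0-⊗ˡ p q (degreeBelow (λ i _ → vanishes h (suc i) z≤n))) j z≤n

DegreeBelow0-⊗ʳ : ∀ p q → DegreeBelow 0 q → DegreeBelow 0 (p ⊗ q)
vanishes (DegreeBelow0-⊗ʳ []      q h) j       _ = refl
vanishes (DegreeBelow0-⊗ʳ (a ∷ p) q h) zero    _
  rewrite coeff-⊗-zero a p q | vanishes h 0 z≤n = *-zeroʳ a
vanishes (DegreeBelow0-⊗ʳ (a ∷ p) q h) (suc j) _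
  rewrite coeff-⊗-suc a p q j | vanishes h (suc j) z≤n | *-zeroʳ a =
  vanishes (DegreeBelow0-⊗ʳ p q h) j z≤n

DegreeBelow-⊗ : ∀ {a b p q} → DegreeBelow (suc a) p → DegreeBelow b q → DegreeBelow (a + b) (p ⊗ q)
vanishes (DegreeBelow-⊗ {p = []} hp hq) j le = refl
vanishes (DegreeBelow-⊗ {a} {p = c ∷ p} {q} hp hq) zero le
  rewrite coeff-⊗-zero c p q | vanishes hq 0 (m+n≤o⇒n≤o a le) = *-zeroʳ c
vanishes (DegreeBelow-⊗ {zero} {p = c ∷ p} {q} hp hq) (suc j) le
  rewrite coeff-⊗-suc c p q j | vanishes hq (suc j) le | *-zeroʳ c =
  vanishes (DegreeBelow0-⊗ˡ p q (DegreeBelow-tail hp)) j z≤n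
vanishes (DegreeBelow-⊗ {suc a} {p = c ∷ p} {q} hp hq) (suc j) le
  rewrite coeff-⊗-suc c p q j | vanishes hq (suc j) (m+n≤o⇒n≤o (suc a) le) | *-zeroʳ c =
  vanishes (DegreeBelow-⊗ (DegreeBelow-tail hp) hq) j (≤-pred le)

coeff-⊗-const : ∀ {p} q j → DegreeBelow 1 p → coeff (p ⊗ q) j ≡ coeff p 0 * coeff q j
coeff-⊗-const {[]}    q j       h = refl
coeff-⊗-const {c ∷ p} q zero    h = coeff-⊗-zero c p q
coeff-⊗-const {c ∷ p} q (suc j) h
  rewrite coeff-⊗-suc c p q j | vanishes (DegreeBelow0-⊗ˡ p q (DegreeBelow-tail h)) j z≤n = +-identityʳ _

coeff-⊗-top : ∀ {a b e p q} → a + b ≡ e → DegreeBelow (suc a) p → DegreeBelow (suc b) q →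
  coeff (p ⊗ q) e ≡ coeff p a * coeff q b
coeff-⊗-top refl = top
  where
  top : ∀ {a b p q} → DegreeBelow (suc a) p → DegreeBelow (suc b) q → coeff (p ⊗ q) (a + b) ≡ coeff p a * coeff q b
  top {p = []}                  hp hq = refl
  top {zero}      {b}           hp hq = coeff-⊗-const _ b hp
  top {suc a} {b} {c ∷ p} {q}   hp hq
    rewrite coeff-⊗-suc c p q (a + b) | vanishes hq (suc (a + b)) (s≤s (m≤n+m b a)) | *-zeroʳ c =
    top (DegreeBelow-tail hp) hq

coeff-⊗-subtop : ∀ {a b e p q} → suc (a + b) ≡ e → DegreeBelow (suc (suc a)) p → DegreeBelow (suc (suc b)) q →
  coeff (p ⊗ q) e ≡ coeff p a * coeff q (suc b) + coeff p (suc a) * coeff q b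
coeff-⊗-subtop refl = subtop
  where
  subtop : ∀ {a b p q} → DegreeBelow (suc (suc a)) p → DegreeBelow (suc (suc b)) q →
    coeff (p ⊗ q) (suc (a + b)) ≡ coeff p a * coeff q (suc b) + coeff p (suc a) * coeff q b
  subtop {p = []}                hp hq = refl
  subtop {zero}  {b} {c ∷ p} {q} hp hq rewrite coeff-⊗-suc c p q b =
    cong (c * coeff q (suc b) +_) (coeff-⊗-const q b (DegreeBelow-tail hp))
  subtop {suc a} {b} {c ∷ p} {q} hp hq
    rewrite coeff-⊗-suc c p q (suc (a + b))
          | vanishes hq (suc (suc (a + b))) (s≤s (s≤s (m≤n+m b a))) | *-zeroʳ c =
    subtop (DegreeBelow-tail hp) hq

DegreeBelow-shift : ∀ {d p} → DegreeBelow d p → DegreeBelow d (shift p)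
vanishes (DegreeBelow-shift {p = []} h) j le = refl
vanishes (DegreeBelow-shift {zero} {a ∷ p} h) j le
  rewrite coeff-⊕ (a ∷ []) ((1 ∷ 1 ∷ []) ⊗ shift p) j
        | vanishes (DegreeBelow0-⊗ʳ (1 ∷ 1 ∷ []) (shift p)
            (DegreeBelow-shift {p = p} (degreeBelow (λ i _ → vanishes h (suc i) z≤n)))) j z≤n
  with j
... | zero   = trans (+-identityʳ a) (vanishes h 0 z≤n)
... | suc _  = refl
vanishes (DegreeBelow-shift {suc d} {a ∷ p} h) (suc j) le
  rewrite coeff-⊕ (a ∷ []) ((1 ∷ 1 ∷ []) ⊗ shift p) (suc j) =
  vanishes (DegreeBelow-⊗ degree-m+1 (DegreeBelow-shift (DegreeBelow-tail h))) (suc j) le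
  where
  degree-m+1 : DegreeBelow 2 (1 ∷ 1 ∷ [])
  vanishes degree-m+1 (suc (suc _)) _         = refl
  vanishes degree-m+1 (suc zero)    (s≤s ())

coeff-shift-top : ∀ {d p} → DegreeBelow (suc d) p → coeff (shift p) d ≡ coeff p d
coeff-shift-top {p = []} h = refl
coeff-shift-top {zero} {a ∷ p} h
  rewrite coeff-⊕ (a ∷ []) ((1 ∷ 1 ∷ []) ⊗ shift p) 0
        | coeff-⊗-zero 1 (1 ∷ []) (shift p)
        | vanishes (DegreeBelow-shift (DegreeBelow-tail h)) 0 z≤n = +-identityʳ a
coeff-shift-top {suc d} {a ∷ p} h
  rewrite coeff-⊕ (a ∷ []) ((1 ∷ 1 ∷ []) ⊗ shift p) (suc d)
        | coeff-⊗-suc 1 (1 ∷ []) (shift p) d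
        | coeff-⊗-const {1 ∷ []} (shift p) d (degreeBelow (λ { (suc _) _ → refl }))
        | vanishes (DegreeBelow-shift (DegreeBelow-tail h)) (suc d) ≤-refl
        | +-identityʳ (coeff (shift p) d) =
  coeff-shift-top (DegreeBelow-tail h)

sumUpTo-cong : ∀ n {f g : ℕ → ℕ} → (∀ k → k ≤ n → f k ≡ g k) → sumUpTo n f ≡ sumUpTo n g
sumUpTo-cong zero    h = h 0 z≤n
sumUpTo-cong (suc n) h = cong₂ _+_ (sumUpTo-cong n (λ k k≤n → h k (m≤n⇒m≤1+n k≤n))) (h (suc n) ≤-refl)

sumUpTo-zero : ∀ n {f : ℕ → ℕ} → (∀ k → k ≤ n → f k ≡ 0) → sumUpTo n f ≡ 0
sumUpTo-zero n h = trans (sumUpTo-cong n h) (zeros n)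
  where
  zeros : ∀ n → sumUpTo n (λ _ → 0) ≡ 0
  zeros zero    = refl
  zeros (suc n) = trans (+-identityʳ _) (zeros n)

sumUpTo-+ : ∀ n (f g : ℕ → ℕ) → sumUpTo n (λ k → f k + g k) ≡ sumUpTo n f + sumUpTo n g
sumUpTo-+ zero    f g = refl
sumUpTo-+ (suc n) f g rewrite sumUpTo-+ n f g =
  interchange (sumUpTo n f) (sumUpTo n g) (f (suc n)) (g (suc n))

sumUpTo-*ˡ : ∀ n c (f : ℕ → ℕ) → sumUpTo n (λ k → c * f k) ≡ c * sumUpTo n f
sumUpTo-*ˡ zero    c f = refl
sumUpTo-*ˡ (suc n) c f rewrite sumUpTo-*ˡ n c f = sym (*-distribˡ-+ c _ _)

sumUpTo-head : ∀ n (f : ℕ → ℕ) → sumUpTo (suc n) f ≡ f 0 + sumUpTo n (f ∘ suc)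
sumUpTo-head zero    f = refl
sumUpTo-head (suc n) f rewrite sumUpTo-head n f = +-assoc (f 0) _ _

sumUpTo-reflect : ∀ n (f : ℕ → ℕ) → sumUpTo n f ≡ sumUpTo n (λ k → f (n ∸ k))
sumUpTo-reflect zero    f = refl
sumUpTo-reflect (suc n) f = begin
  sumUpTo n f + f (suc n)                    ≡⟨ cong (_+ f (suc n)) (sumUpTo-reflect n f) ⟩
  sumUpTo n (λ k → f (n ∸ k)) + f (suc n)    ≡⟨ +-comm _ (f (suc n)) ⟩
  f (suc n) + sumUpTo n (λ k → f (n ∸ k))    ≡⟨ sumUpTo-head n (λ k → f (suc n ∸ k)) ⟨
  sumUpTo (suc n) (λ k → f (suc n ∸ k))      ∎
  where open ≡-Reasoning

double : ℕ → ℕ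
double zero    = zero
double (suc i) = suc (suc (double i))

double≡+ : ∀ i → double i ≡ i + i
double≡+ zero    = refl
double≡+ (suc i) = cong suc (trans (cong suc (double≡+ i)) (sym (+-suc i i)))

double≡2* : ∀ i → double i ≡ 2 * i
double≡2* i = trans (double≡+ i) (cong (i +_) (sym (+-identityʳ i)))

double-∸ : ∀ a b → double a ∸ double b ≡ double (a ∸ b)
double-∸ a       zero    = refl
double-∸ zero    (suc b) = refl
double-∸ (suc a) (suc b) = double-∸ a b

suc-double-∸ : ∀ {a b} → b ≤ a → suc (double a) ∸ double b ≡ suc (double (a ∸ b))
suc-double-∸ z≤n       = refl
suc-double-∸ (s≤s b≤a) = suc-double-∸ b≤a

sumUpTo-odd-split : ∀ i (f : ℕ → ℕ) →
  sumUpTo (suc (double i)) f ≡ sumUpTo i (f ∘ double) + sumUpTo i (f ∘ suc ∘ double)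
sumUpTo-odd-split zero    f = refl
sumUpTo-odd-split (suc i) f rewrite sumUpTo-odd-split i f =
  trans (+-assoc (evens + odds) (f (double (suc i))) (f (suc (double (suc i)))))
        (interchange evens odds (f (double (suc i))) (f (suc (double (suc i)))))
  where
  evens odds : ℕ
  evens = sumUpTo i (f ∘ double)
  odds  = sumUpTo i (f ∘ suc ∘ double)

sumUpTo-even-split : ∀ i (f : ℕ → ℕ) →
  sumUpTo (double (suc i)) f ≡ sumUpTo (suc i) (f ∘ double) + sumUpTo i (f ∘ suc ∘ double)
sumUpTo-even-split i f rewrite sumUpTo-odd-split i f =
  xy∙z≈xz∙y (sumUpTo i (f ∘ double)) (sumUpTo i (f ∘ suc ∘ double)) (f (double (suc i)))

upTo-suc : ∀ n → upTo (suc n) ≡ 0 ∷ map suc (upTo n)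
upTo-suc n = cong (0 ∷_) (sym (map-upTo suc n))

reverse-upTo : ∀ n → reverse (upTo (suc n)) ≡ map (n ∸_) (upTo (suc n))
reverse-upTo zero    = refl
reverse-upTo (suc n) = begin
  reverse (upTo (suc (suc n)))                     ≡⟨ cong reverse (upTo-∷ʳ (suc n)) ⟨
  reverse (upTo (suc n) ∷ʳ suc n)                  ≡⟨ reverse-++ (upTo (suc n)) (suc n ∷ []) ⟩
  suc n ∷ reverse (upTo (suc n))                   ≡⟨ cong (suc n ∷_) (reverse-upTo n) ⟩
  suc n ∷ map (n ∸_) (upTo (suc n))                ≡⟨ cong (suc n ∷_) (map-∘ (upTo (suc n))) ⟩
  suc n ∷ map (suc n ∸_) (map suc (upTo (suc n)))  ≡⟨ cong (map (suc n ∸_)) (upTo-suc (suc n)) ⟨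
  map (suc n ∸_) (upTo (suc (suc n)))              ∎
  where open ≡-Reasoning

sum-map-upTo : ∀ n (f : ℕ → ℕ) → sum (map f (upTo (suc n))) ≡ sumUpTo n f
sum-map-upTo zero    f = +-identityʳ (f 0)
sum-map-upTo (suc n) f = begin
  sum (map f (upTo (suc (suc n))))            ≡⟨ cong (sum ∘ map f) (upTo-∷ʳ (suc n)) ⟨
  sum (map f (upTo (suc n) ∷ʳ suc n))         ≡⟨ cong sum (map-++ f (upTo (suc n)) (suc n ∷ [])) ⟩
  sum (map f (upTo (suc n)) ∷ʳ f (suc n))     ≡⟨ sum-++ (map f (upTo (suc n))) (f (suc n) ∷ []) ⟩
  sum (map f (upTo (suc n))) + (f (suc n) + 0) ≡⟨ cong₂ _+_ (sum-map-upTo n f) (+-identityʳ _) ⟩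
  sumUpTo n f + f (suc n)                     ∎
  where open ≡-Reasoning

coeff-polySum : ∀ {A : Set} (F : A → Poly) xs j →
  coeff (polySum (map F xs)) j ≡ sum (map (λ x → coeff (F x) j) xs)
coeff-polySum F []       j = refl
coeff-polySum F (x ∷ xs) j = trans (coeff-⊕ (F x) _ j) (cong (_ +_) (coeff-polySum F xs j))

zipWith-diagonal : ∀ {A B C D : Set} (f : B → C → D) (g : A → B) (h : A → C) xs →
  zipWith f (map g xs) (map h xs) ≡ map (λ x → f (g x) (h x)) xs
zipWith-diagonal f g h []       = refl
zipWith-diagonal f g h (x ∷ xs) = cong (_ ∷_) (zipWith-diagonal f g h xs)

lastPair-∷ʳ : ∀ xs (x : Poly × Poly) → lastPair (xs ∷ʳ x) ≡ x
lastPair-∷ʳ []           x = refl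
lastPair-∷ʳ (y ∷ [])     x = refl
lastPair-∷ʳ (y ∷ z ∷ zs) x = lastPair-∷ʳ (z ∷ zs) x

PQ : ℕ → Poly × Poly
PQ k = P k , Q k

PQ-suc-suc : ∀ n → PQ (suc (suc n)) ≡ nextPair (table (suc n))
PQ-suc-suc n = lastPair-∷ʳ (table (suc n)) (nextPair (table (suc n)))

table≡map-PQ : ∀ n → table n ≡ map PQ (upTo (suc n))
table≡map-PQ zero          = refl
table≡map-PQ (suc zero)    = refl
table≡map-PQ (suc (suc n)) = begin
  table (suc n) ∷ʳ nextPair (table (suc n))        ≡⟨ cong₂ _∷ʳ_ (table≡map-PQ (suc n)) (sym (PQ-suc-suc n)) ⟩
  map PQ (upTo (suc (suc n))) ∷ʳ PQ (suc (suc n))  ≡⟨ map-++ PQ (upTo (suc (suc n))) (suc (suc n) ∷ []) ⟨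
  map PQ (upTo (suc (suc n)) ∷ʳ suc (suc n))       ≡⟨ cong (map PQ) (upTo-∷ʳ (suc (suc n))) ⟩
  map PQ (upTo (suc (suc (suc n))))                ∎
  where open ≡-Reasoning

coeff-Q-suc-suc : ∀ n j →
  coeff (Q (suc (suc n))) j ≡ sumUpTo (suc n) (λ k → coeff (Q (suc n ∸ k) ⊗ P k) j)
coeff-Q-suc-suc n j = begin
  coeff (Q (suc (suc n))) j
    ≡⟨ cong (λ pq → coeff (proj₂ pq) j) (PQ-suc-suc n) ⟩
  coeff (polySum (zipWith _⊗_ (reverse (map proj₂ (table (suc n)))) (map proj₁ (table (suc n))))) j
    ≡⟨ cong₂ (λ qs ps → coeff (polySum (zipWith _⊗_ (reverse qs) ps)) j) (column proj₂) (column proj₁) ⟩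
  coeff (polySum (zipWith _⊗_ (reverse (map Q ks)) (map P ks))) j
    ≡⟨ cong (λ qs → coeff (polySum (zipWith _⊗_ qs (map P ks))) j) reversed-Qs ⟩
  coeff (polySum (zipWith _⊗_ (map (λ k → Q (suc n ∸ k)) ks) (map P ks))) j
    ≡⟨ cong (λ ts → coeff (polySum ts) j) (zipWith-diagonal _⊗_ (λ k → Q (suc n ∸ k)) P ks) ⟩
  coeff (polySum (map (λ k → Q (suc n ∸ k) ⊗ P k) ks)) j
    ≡⟨ coeff-polySum (λ k → Q (suc n ∸ k) ⊗ P k) ks j ⟩
  sum (map (λ k → coeff (Q (suc n ∸ k) ⊗ P k) j) ks)
    ≡⟨ sum-map-upTo (suc n) _ ⟩
  sumUpTo (suc n) (λ k → coeff (Q (suc n ∸ k) ⊗ P k) j)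
    ∎
  where
  open ≡-Reasoning
  ks = upTo (suc (suc n))
  column : (π : Poly × Poly → Poly) → map π (table (suc n)) ≡ map (π ∘ PQ) ks
  column π = trans (cong (map π) (table≡map-PQ (suc n))) (sym (map-∘ ks))
  reversed-Qs : reverse (map Q ks) ≡ map (λ k → Q (suc n ∸ k)) ks
  reversed-Qs = begin
    reverse (map Q ks)            ≡⟨ reverse-map Q ks ⟨
    map Q (reverse ks)            ≡⟨ cong (map Q) (reverse-upTo (suc n)) ⟩
    map Q (map (suc n ∸_) ks)     ≡⟨ map-∘ ks ⟨
    map (λ k → Q (suc n ∸ k)) ks  ∎

coeff-P-suc-suc : ∀ n j →
  coeff (P (suc (suc n))) j ≡ coeff (shift (P (suc n))) j + coeff (Q (suc (suc n))) j
coeff-P-suc-suc n j = begin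
  coeff (P (suc (suc n))) j
    ≡⟨ cong (λ pq → coeff (proj₁ pq) j) (PQ-suc-suc n) ⟩
  coeff (shift (P (suc n)) ⊕ proj₂ (nextPair (table (suc n)))) j
    ≡⟨ cong (λ pq → coeff (shift (P (suc n)) ⊕ proj₂ pq) j) (PQ-suc-suc n) ⟨
  coeff (shift (P (suc n)) ⊕ Q (suc (suc n))) j
    ≡⟨ coeff-⊕ (shift (P (suc n))) (Q (suc (suc n))) j ⟩
  coeff (shift (P (suc n))) j + coeff (Q (suc (suc n))) j ∎
  where open ≡-Reasoning

⌈/2⌉-+ : ∀ a b → ⌈ a /2⌉ + ⌈ b /2⌉ ≤ ⌈ suc (a + b) /2⌉
⌈/2⌉-+ zero          b = ⌈n/2⌉-mono (n≤1+n b)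
⌈/2⌉-+ (suc zero)    b = ≤-refl
⌈/2⌉-+ (suc (suc a)) b = s≤s (⌈/2⌉-+ a b)

DegreeBelow-PQ : ℕ → ℕ → Set
DegreeBelow-PQ d n = DegreeBelow (suc d) (P n) × DegreeBelow (suc d) (Q n)

degree-PQ : ∀ n → DegreeBelow-PQ ⌈ n /2⌉ n
degree-PQ = <-rec (λ n → DegreeBelow-PQ ⌈ n /2⌉ n) step
  where
  step : ∀ n → (∀ {m} → m < n → DegreeBelow-PQ ⌈ m /2⌉ m) → DegreeBelow-PQ ⌈ n /2⌉ n
  step zero          ih = degreeBelow (λ _ _ → refl) , degreeBelow (λ _ _ → refl)
  step (suc zero)    ih = degree-m , degree-m
    where
    degree-m : DegreeBelow 2 varM
    vanishes degree-m (suc (suc _)) _        = refl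
    vanishes degree-m (suc zero)    (s≤s ())
  step (suc (suc n)) ih = degree-P , degree-Q
    where
    degree-term : ∀ k → k ≤ suc n → DegreeBelow (suc (suc ⌈ n /2⌉)) (Q (suc n ∸ k) ⊗ P k)
    degree-term k k≤1+n =
      DegreeBelow-mono bound (DegreeBelow-⊗ (proj₂ (ih (s≤s (m∸n≤m (suc n) k)))) (proj₁ (ih (s≤s k≤1+n))))
      where
      open ≤-Reasoning
      bound : ⌈ suc n ∸ k /2⌉ + suc ⌈ k /2⌉ ≤ suc (suc ⌈ n /2⌉)
      bound = begin
        ⌈ suc n ∸ k /2⌉ + suc ⌈ k /2⌉     ≡⟨ +-suc ⌈ suc n ∸ k /2⌉ ⌈ k /2⌉ ⟩
        suc (⌈ suc n ∸ k /2⌉ + ⌈ k /2⌉)   ≤⟨ s≤s (⌈/2⌉-+ (suc n ∸ k) k) ⟩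
        suc ⌈ suc (suc n ∸ k + k) /2⌉     ≡⟨ cong (λ m → suc ⌈ suc m /2⌉) (m∸n+n≡m k≤1+n) ⟩
        suc ⌈ suc (suc n) /2⌉             ∎
    degree-Q : DegreeBelow (suc ⌈ suc (suc n) /2⌉) (Q (suc (suc n)))
    vanishes degree-Q j le = trans (coeff-Q-suc-suc n j)
      (sumUpTo-zero (suc n) (λ k k≤1+n → vanishes (degree-term k k≤1+n) j le))
    degree-P : DegreeBelow (suc ⌈ suc (suc n) /2⌉) (P (suc (suc n)))
    vanishes degree-P j le = trans (coeff-P-suc-suc n j) (cong₂ _+_ (vanishes shifted j le) (vanishes degree-Q j le))
      where
      shifted : DegreeBelow (suc ⌈ suc (suc n) /2⌉) (shift (P (suc n)))
      shifted = DegreeBelow-shift (DegreeBelow-mono (s≤s (⌈n/2⌉-mono (n≤1+n (suc n)))) (proj₁ (ih ≤-refl)))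

-- Formal power series

infixl 6 _⊞_
_⊞_ : Series → Series → Series
(f ⊞ g) n = f n + g n

𝟘 𝟙 z : Series
𝟘 _ = 0
𝟙 zero    = 1
𝟙 (suc _) = 0
z (suc zero) = 1
z _          = 0

⋆-cong : ∀ {f f′ g g′} → f ≗ f′ → g ≗ g′ → f ⋆ g ≗ f′ ⋆ g′
⋆-cong f≗f′ g≗g′ n = sumUpTo-cong n (λ k _ → cong₂ _*_ (f≗f′ k) (g≗g′ (n ∸ k)))

⊞-cong : ∀ {f f′ g g′} → f ≗ f′ → g ≗ g′ → f ⊞ g ≗ f′ ⊞ g′
⊞-cong f≗f′ g≗g′ n = cong₂ _+_ (f≗f′ n) (g≗g′ n)

⊞-congˡ : ∀ f {g g′} → g ≗ g′ → f ⊞ g ≗ f ⊞ g′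
⊞-congˡ f = ⊞-cong {f} {f} (λ _ → refl)

⊞-congʳ : ∀ {f f′} g → f ≗ f′ → f ⊞ g ≗ f′ ⊞ g
⊞-congʳ g f≗f′ = ⊞-cong {g = g} f≗f′ (λ _ → refl)

⊞-cancelʳ : ∀ {f g} h → f ⊞ h ≗ g ⊞ h → f ≗ g
⊞-cancelʳ {f} {g} h e n = +-cancelʳ-≡ (h n) (f n) (g n) (e n)

⋆-congˡ : ∀ f {g g′} → g ≗ g′ → f ⋆ g ≗ f ⋆ g′
⋆-congˡ f g≗g′ = ⋆-cong {f} {f} (λ _ → refl) g≗g′

⋆-congʳ : ∀ {f f′} g → f ≗ f′ → f ⋆ g ≗ f′ ⋆ g
⋆-congʳ g f≗f′ = ⋆-cong {g = g} f≗f′ (λ _ → refl)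

⋆-suc : ∀ f g n → (f ⋆ g) (suc n) ≡ f 0 * g (suc n) + ((f ∘ suc) ⋆ g) n
⋆-suc f g n = sumUpTo-head n (λ k → f k * g (suc n ∸ k))

⋆-swapped : ∀ n f g → sumUpTo n (λ k → g (n ∸ k) * f k) ≡ (f ⋆ g) n
⋆-swapped n f g = sumUpTo-cong n (λ k _ → *-comm (g (n ∸ k)) (f k))

⋆-comm : ∀ f g → f ⋆ g ≗ g ⋆ f
⋆-comm f g n = trans (sumUpTo-reflect n (λ k → f k * g (n ∸ k)))
  (sumUpTo-cong n (λ k k≤n → trans (cong (λ m → f (n ∸ k) * g m) (m∸[m∸n]≡n k≤n))
                                   (*-comm (f (n ∸ k)) (g k))))

⋆-distribʳ : ∀ f g h → (f ⊞ g) ⋆ h ≗ f ⋆ h ⊞ g ⋆ h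
⋆-distribʳ f g h n = trans (sumUpTo-cong n (λ k _ → *-distribʳ-+ (h (n ∸ k)) (f k) (g k)))
  (sumUpTo-+ n (λ k → f k * h (n ∸ k)) (λ k → g k * h (n ∸ k)))

⋆-scaleˡ : ∀ c f g n → ((λ m → c * f m) ⋆ g) n ≡ c * (f ⋆ g) n
⋆-scaleˡ c f g n = trans (sumUpTo-cong n (λ k _ → *-assoc c (f k) (g (n ∸ k))))
  (sumUpTo-*ˡ n c (λ k → f k * g (n ∸ k)))

⋆-assoc : ∀ f g h → (f ⋆ g) ⋆ h ≗ f ⋆ (g ⋆ h)
⋆-assoc f g h zero    = *-assoc (f 0) (g 0) (h 0)
⋆-assoc f g h (suc n) = begin
  ((f ⋆ g) ⋆ h) (suc n)
    ≡⟨ ⋆-suc (f ⋆ g) h n ⟩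
  f 0 * g 0 * h (suc n) + (((f ⋆ g) ∘ suc) ⋆ h) n
    ≡⟨ cong (f 0 * g 0 * h (suc n) +_) (⋆-congʳ h (⋆-suc f g) n) ⟩
  f 0 * g 0 * h (suc n) + ((f0g′ ⊞ (f ∘ suc) ⋆ g) ⋆ h) n
    ≡⟨ cong (f 0 * g 0 * h (suc n) +_) (⋆-distribʳ f0g′ ((f ∘ suc) ⋆ g) h n) ⟩
  f 0 * g 0 * h (suc n) + ((f0g′ ⋆ h) n + (((f ∘ suc) ⋆ g) ⋆ h) n)
    ≡⟨ cong₂ (λ a b → f 0 * g 0 * h (suc n) + (a + b)) (⋆-scaleˡ (f 0) (g ∘ suc) h n) (⋆-assoc (f ∘ suc) g h n) ⟩
  f 0 * g 0 * h (suc n) + (f 0 * ((g ∘ suc) ⋆ h) n + ((f ∘ suc) ⋆ (g ⋆ h)) n)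
    ≡⟨ regroup (f 0) (g 0) (h (suc n)) (((g ∘ suc) ⋆ h) n) (((f ∘ suc) ⋆ (g ⋆ h)) n) ⟩
  f 0 * (g 0 * h (suc n) + ((g ∘ suc) ⋆ h) n) + ((f ∘ suc) ⋆ (g ⋆ h)) n
    ≡⟨ cong (λ a → f 0 * a + ((f ∘ suc) ⋆ (g ⋆ h)) n) (⋆-suc g h n) ⟨
  f 0 * (g ⋆ h) (suc n) + ((f ∘ suc) ⋆ (g ⋆ h)) n
    ≡⟨ ⋆-suc f (g ⋆ h) n ⟨
  (f ⋆ (g ⋆ h)) (suc n)
    ∎
  where
  open ≡-Reasoning
  f0g′ : Series
  f0g′ m = f 0 * g (suc m)
  regroup : ∀ a b c d e → a * b * c + (a * d + e) ≡ a * (b * c + d) + e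
  regroup = solve-∀

⋆-identityˡ : ∀ f → 𝟙 ⋆ f ≗ f
⋆-identityˡ f zero    = +-identityʳ (f 0)
⋆-identityˡ f (suc n) = begin
  (𝟙 ⋆ f) (suc n)                           ≡⟨ ⋆-suc 𝟙 f n ⟩
  1 * f (suc n) + ((𝟙 ∘ suc) ⋆ f) n         ≡⟨ cong (1 * f (suc n) +_) (sumUpTo-zero n (λ _ _ → refl)) ⟩
  1 * f (suc n) + 0                         ≡⟨ trans (+-identityʳ _) (*-identityˡ _) ⟩
  f (suc n)                                 ∎
  where open ≡-Reasoning

⋆-zeroˡ : ∀ f → 𝟘 ⋆ f ≗ 𝟘
⋆-zeroˡ f n = sumUpTo-zero n (λ _ _ → refl)

z⋆-suc : ∀ f n → (z ⋆ f) (suc n) ≡ f n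
z⋆-suc f n = begin
  (z ⋆ f) (suc n)           ≡⟨ ⋆-suc z f n ⟩
  ((z ∘ suc) ⋆ f) n         ≡⟨ ⋆-congʳ {z ∘ suc} {𝟙} f (λ { zero → refl ; (suc _) → refl }) n ⟩
  (𝟙 ⋆ f) n                 ≡⟨ ⋆-identityˡ f n ⟩
  f n                       ∎
  where open ≡-Reasoning

≗-refl : ∀ {f : Series} → f ≗ f
≗-refl _ = refl

≗-sym : ∀ {f g : Series} → f ≗ g → g ≗ f
≗-sym f≗g n = sym (f≗g n)

≗-trans : ∀ {f g h : Series} → f ≗ g → g ≗ h → f ≗ h
≗-trans f≗g g≗h n = trans (f≗g n) (g≗h n)

≗-isEquivalence : IsEquivalence {A = Series} _≗_
≗-isEquivalence = record { refl = ≗-refl ; sym = ≗-sym ; trans = ≗-trans }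

seriesSemiring : CommutativeSemiring 0ℓ 0ℓ
seriesSemiring = record
  { Carrier = Series ; _≈_ = _≗_ ; _+_ = _⊞_ ; _*_ = _⋆_ ; 0# = 𝟘 ; 1# = 𝟙
  ; isCommutativeSemiring = IsCommutativeSemiringˡ.isCommutativeSemiring record
    { +-isCommutativeMonoid = record
      { isMonoid = record
        { isSemigroup = record
          { isMagma = record { isEquivalence = ≗-isEquivalence ; ∙-cong = ⊞-cong }
          ; assoc   = λ f g h n → +-assoc (f n) (g n) (h n) }
        ; identity = (λ _ _ → refl) , (λ f n → +-identityʳ (f n)) }
      ; comm = λ f g n → +-comm (f n) (g n) }
    ; *-isCommutativeMonoid = record
      { isMonoid = record
        { isSemigroup = record
          { isMagma = record { isEquivalence = ≗-isEquivalence ; ∙-cong = ⋆-cong }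
          ; assoc   = ⋆-assoc }
        ; identity = ⋆-identityˡ , (λ f n → trans (⋆-comm f 𝟙 n) (⋆-identityˡ f n)) }
      ; comm = ⋆-comm }
    ; distribʳ = λ h f g → ⋆-distribʳ f g h
    ; zeroˡ    = ⋆-zeroˡ
    }
  }

⋆-cong-upTo : ∀ n {f f′ g g′ : Series} → (∀ k → k ≤ n → f k ≡ f′ k) → (∀ k → k ≤ n → g k ≡ g′ k) →
  (f ⋆ g) n ≡ (f′ ⋆ g′) n
⋆-cong-upTo n f≡f′ g≡g′ = sumUpTo-cong n (λ k k≤n → cong₂ _*_ (f≡f′ k k≤n) (g≡g′ (n ∸ k) (m∸n≤m n k)))

linear-unique : ∀ {X Y} K L M → X ⊞ K ≗ L ⊞ z ⋆ (M ⋆ X) → Y ⊞ K ≗ L ⊞ z ⋆ (M ⋆ Y) → X ≗ Y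
linear-unique {X} {Y} K L M hX hY = <-rec (λ n → X n ≡ Y n) step
  where
  step : ∀ n → (∀ {m} → m < n → X m ≡ Y m) → X n ≡ Y n
  step zero    _  = +-cancelʳ-≡ (K 0) (X 0) (Y 0) (trans (hX 0) (sym (hY 0)))
  step (suc n) ih = +-cancelʳ-≡ (K (suc n)) (X (suc n)) (Y (suc n)) (begin
    X (suc n) + K (suc n)
      ≡⟨ hX (suc n) ⟩
    L (suc n) + (z ⋆ (M ⋆ X)) (suc n)
      ≡⟨ cong (L (suc n) +_) (z⋆-suc (M ⋆ X) n) ⟩
    L (suc n) + (M ⋆ X) n
      ≡⟨ cong (L (suc n) +_) (⋆-cong-upTo n {f = M} (λ _ _ → refl) (λ k k≤n → ih (s≤s k≤n))) ⟩
    L (suc n) + (M ⋆ Y) n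
      ≡⟨ cong (L (suc n) +_) (z⋆-suc (M ⋆ Y) n) ⟨
    L (suc n) + (z ⋆ (M ⋆ Y)) (suc n)
      ≡⟨ hY (suc n) ⟨
    Y (suc n) + K (suc n) ∎)
    where open ≡-Reasoning

inner : Series → Series → Series
inner f g zero    = 0
inner f g (suc m) = ((f ∘ suc) ⋆ (g ∘ suc)) m

⋆-suc-split : ∀ f g n → (f ⋆ g) (suc n) ≡ f 0 * g (suc n) + (f (suc n) * g 0 + inner f g n)
⋆-suc-split f g n = trans (⋆-suc f g n) (cong (f 0 * g (suc n) +_) (tail n))
  where
  tail : ∀ n → ((f ∘ suc) ⋆ g) n ≡ f (suc n) * g 0 + inner f g n
  tail zero    = sym (+-identityʳ _)
  tail (suc m) = begin
    ((f ∘ suc) ⋆ g) (suc m)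
      ≡⟨ ⋆-comm (f ∘ suc) g (suc m) ⟩
    (g ⋆ (f ∘ suc)) (suc m)
      ≡⟨ ⋆-suc g (f ∘ suc) m ⟩
    g 0 * f (suc (suc m)) + ((g ∘ suc) ⋆ (f ∘ suc)) m
      ≡⟨ cong₂ _+_ (*-comm (g 0) _) (⋆-comm (g ∘ suc) (f ∘ suc) m) ⟩
    f (suc (suc m)) * g 0 + ((f ∘ suc) ⋆ (g ∘ suc)) m ∎
    where open ≡-Reasoning

inner-cong : ∀ n {f f′ g g′ : Series} → (∀ k → k ≤ n → f k ≡ f′ k) → (∀ k → k ≤ n → g k ≡ g′ k) →
  inner f g n ≡ inner f′ g′ n
inner-cong zero    f≡f′ g≡g′ = refl
inner-cong (suc m) f≡f′ g≡g′ =
  ⋆-cong-upTo m (λ k k≤m → f≡f′ (suc k) (s≤s k≤m)) (λ k k≤m → g≡g′ (suc k) (s≤s k≤m))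

+-self-injective : ∀ {m n} → m + m ≡ n + n → m ≡ n
+-self-injective {m} {n} eq = *-cancelˡ-≡ m n 2 (begin
  2 * m      ≡⟨ cong (m +_) (+-identityʳ m) ⟩
  m + m      ≡⟨ eq ⟩
  n + n      ≡⟨ cong (n +_) (+-identityʳ n) ⟨
  2 * n      ∎)
  where open ≡-Reasoning

-- Coefficient n+1 of X ⋆ X is 2 X (n+1) plus products of X 1, …, X n, so the equation fixes X (n+1).
quadratic-unique : ∀ {X Y} K L M → X 0 ≡ 1 → Y 0 ≡ 1 → M 0 ≡ 0 →
  X ⋆ X ⊞ K ≗ L ⊞ X ⋆ M → Y ⋆ Y ⊞ K ≗ L ⊞ Y ⋆ M → X ≗ Y
quadratic-unique {X} {Y} K L M x0 y0 m0 hX hY = <-rec (λ n → X n ≡ Y n) step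
  where
  open ≡-Reasoning

  coefficient-suc : ∀ {A} → A 0 ≡ 1 → A ⋆ A ⊞ K ≗ L ⊞ A ⋆ M → ∀ n →
    A (suc n) + A (suc n) + (inner A A n + K (suc n)) ≡ L (suc n) + (M (suc n) + inner A M n)
  coefficient-suc {A} a0 hA n = begin
    A (suc n) + A (suc n) + (inner A A n + K (suc n))
      ≡⟨ sym (+-assoc (A (suc n) + A (suc n)) _ _) ⟩
    A (suc n) + A (suc n) + inner A A n + K (suc n)
      ≡⟨ cong (λ a → a + A (suc n) + inner A A n + K (suc n)) (*-identityˡ (A (suc n))) ⟨
    1 * A (suc n) + A (suc n) + inner A A n + K (suc n)
      ≡⟨ cong (_+ K (suc n)) (+-assoc (1 * A (suc n)) (A (suc n)) _) ⟩
    1 * A (suc n) + (A (suc n) + inner A A n) + K (suc n)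
      ≡⟨ cong (λ a → 1 * A (suc n) + (a + inner A A n) + K (suc n)) (*-identityʳ (A (suc n))) ⟨
    1 * A (suc n) + (A (suc n) * 1 + inner A A n) + K (suc n)
      ≡⟨ cong (λ a → a * A (suc n) + (A (suc n) * a + inner A A n) + K (suc n)) a0 ⟨
    A 0 * A (suc n) + (A (suc n) * A 0 + inner A A n) + K (suc n)
      ≡⟨ cong (_+ K (suc n)) (⋆-suc-split A A n) ⟨
    (A ⋆ A) (suc n) + K (suc n)
      ≡⟨ hA (suc n) ⟩
    L (suc n) + (A ⋆ M) (suc n)
      ≡⟨ cong (L (suc n) +_) (⋆-suc-split A M n) ⟩
    L (suc n) + (A 0 * M (suc n) + (A (suc n) * M 0 + inner A M n))
      ≡⟨ cong₂ (λ a b → L (suc n) + (a * M (suc n) + (A (suc n) * b + inner A M n))) a0 m0 ⟩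
    L (suc n) + (1 * M (suc n) + (A (suc n) * 0 + inner A M n))
      ≡⟨ cong₂ (λ a b → L (suc n) + (a + (b + inner A M n))) (*-identityˡ (M (suc n))) (*-zeroʳ (A (suc n))) ⟩
    L (suc n) + (M (suc n) + inner A M n)
      ∎

  step : ∀ n → (∀ {m} → m < n → X m ≡ Y m) → X n ≡ Y n
  step zero    _  = trans x0 (sym y0)
  step (suc n) ih = +-self-injective (+-cancelʳ-≡ _ (X (suc n) + X (suc n)) (Y (suc n) + Y (suc n)) (begin
    X (suc n) + X (suc n) + (inner X X n + K (suc n))
      ≡⟨ coefficient-suc x0 hX n ⟩
    L (suc n) + (M (suc n) + inner X M n)
      ≡⟨ cong (λ i → L (suc n) + (M (suc n) + i)) (inner-cong n {g = M} agree (λ _ _ → refl)) ⟩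
    L (suc n) + (M (suc n) + inner Y M n)
      ≡⟨ coefficient-suc y0 hY n ⟨
    Y (suc n) + Y (suc n) + (inner Y Y n + K (suc n))
      ≡⟨ cong (λ i → Y (suc n) + Y (suc n) + (i + K (suc n))) (inner-cong n agree agree) ⟨
    Y (suc n) + Y (suc n) + (inner X X n + K (suc n)) ∎))
    where
    agree : ∀ k → k ≤ n → X k ≡ Y k
    agree k k≤n = ih (s≤s k≤n)

-- The two top diagonals

⌈double/2⌉ : ∀ i → ⌈ double i /2⌉ ≡ i
⌈double/2⌉ zero    = refl
⌈double/2⌉ (suc i) = cong suc (⌈double/2⌉ i)

⌈suc-double/2⌉ : ∀ i → ⌈ suc (double i) /2⌉ ≡ suc i
⌈suc-double/2⌉ zero    = refl
⌈suc-double/2⌉ (suc i) = cong suc (⌈suc-double/2⌉ i)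

degree-PQ-even : ∀ i → DegreeBelow-PQ i (double i)
degree-PQ-even i = subst (λ d → DegreeBelow-PQ d (double i)) (⌈double/2⌉ i) (degree-PQ (double i))

degree-PQ-odd : ∀ i → DegreeBelow-PQ (suc i) (suc (double i))
degree-PQ-odd i = subst (λ d → DegreeBelow-PQ d (suc (double i))) (⌈suc-double/2⌉ i) (degree-PQ (suc (double i)))

degree-P-even : ∀ i → DegreeBelow (suc i) (P (double i))
degree-P-even i = proj₁ (degree-PQ-even i)

degree-Q-even : ∀ i → DegreeBelow (suc i) (Q (double i))
degree-Q-even i = proj₂ (degree-PQ-even i)

degree-P-odd : ∀ i → DegreeBelow (suc (suc i)) (P (suc (double i)))
degree-P-odd i = proj₁ (degree-PQ-odd i)

degree-Q-odd : ∀ i → DegreeBelow (suc (suc i)) (Q (suc (double i)))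
degree-Q-odd i = proj₂ (degree-PQ-odd i)

coeff-Q-odd : ∀ i j → coeff (Q (suc (double (suc i)))) j ≡
  sumUpTo (suc i) (λ k → coeff (Q (double (suc i ∸ k)) ⊗ P (double k)) j) +
  sumUpTo i (λ k → coeff (Q (suc (double (i ∸ k))) ⊗ P (suc (double k))) j)
coeff-Q-odd i j = begin
  coeff (Q (suc (double (suc i)))) j
    ≡⟨ coeff-Q-suc-suc (suc (double i)) j ⟩
  sumUpTo (double (suc i)) term
    ≡⟨ sumUpTo-even-split i term ⟩
  sumUpTo (suc i) (term ∘ double) + sumUpTo i (term ∘ suc ∘ double)
    ≡⟨ cong₂ _+_ (sumUpTo-cong (suc i) (λ k _ → cong (λ m → coeff (Q m ⊗ P (double k)) j) (double-∸ (suc i) k)))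
                 (sumUpTo-cong i (λ k k≤i → cong (λ m → coeff (Q m ⊗ P (suc (double k))) j) (suc-double-∸ k≤i))) ⟩
  sumUpTo (suc i) (λ k → coeff (Q (double (suc i ∸ k)) ⊗ P (double k)) j) +
  sumUpTo i (λ k → coeff (Q (suc (double (i ∸ k))) ⊗ P (suc (double k))) j)
    ∎
  where
  open ≡-Reasoning
  term : ℕ → ℕ
  term k = coeff (Q (double (suc i) ∸ k) ⊗ P k) j

coeff-Q-even : ∀ i j → coeff (Q (double (suc i))) j ≡
  sumUpTo i (λ k → coeff (Q (suc (double (i ∸ k))) ⊗ P (double k)) j) +
  sumUpTo i (λ k → coeff (Q (double (i ∸ k)) ⊗ P (suc (double k))) j)
coeff-Q-even i j = begin
  coeff (Q (double (suc i))) j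
    ≡⟨ coeff-Q-suc-suc (double i) j ⟩
  sumUpTo (suc (double i)) term
    ≡⟨ sumUpTo-odd-split i term ⟩
  sumUpTo i (term ∘ double) + sumUpTo i (term ∘ suc ∘ double)
    ≡⟨ cong₂ _+_ (sumUpTo-cong i (λ k k≤i → cong (λ m → coeff (Q m ⊗ P (double k)) j) (suc-double-∸ k≤i)))
                 (sumUpTo-cong i (λ k _ → cong (λ m → coeff (Q m ⊗ P (suc (double k))) j) (double-∸ i k))) ⟩
  sumUpTo i (λ k → coeff (Q (suc (double (i ∸ k))) ⊗ P (double k)) j) +
  sumUpTo i (λ k → coeff (Q (double (i ∸ k)) ⊗ P (suc (double k))) j)
    ∎
  where
  open ≡-Reasoning
  term : ℕ → ℕ
  term k = coeff (Q (suc (double i) ∸ k) ⊗ P k) j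

topQ-odd topP-odd topQ-even topP-even nextQ-odd nextP-odd : Series
topQ-odd  i = coeff (Q (suc (double i))) (suc i)
topP-odd  i = coeff (P (suc (double i))) (suc i)
topQ-even i = coeff (Q (double i)) i
topP-even i = coeff (P (double i)) i
nextQ-odd i = coeff (Q (suc (double i))) i
nextP-odd i = coeff (P (suc (double i))) i

∸+suc≡suc : ∀ {i k} → k ≤ i → (i ∸ k) + suc k ≡ suc i
∸+suc≡suc {i} {k} k≤i = trans (+-suc (i ∸ k) k) (cong suc (m∸n+n≡m k≤i))

topP-odd≗topQ-odd : topP-odd ≗ topQ-odd
topP-odd≗topQ-odd zero    = refl
topP-odd≗topQ-odd (suc i) = begin
  topP-odd (suc i)
    ≡⟨ coeff-P-suc-suc (suc (double i)) (suc (suc i)) ⟩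
  coeff (shift (P (double (suc i)))) (suc (suc i)) + topQ-odd (suc i)
    ≡⟨ cong (_+ topQ-odd (suc i)) (vanishes (DegreeBelow-shift (degree-P-even (suc i))) (suc (suc i)) ≤-refl) ⟩
  topQ-odd (suc i) ∎
  where open ≡-Reasoning

topQ-odd-equation : topQ-odd ≗ 𝟙 ⊞ z ⋆ (topQ-odd ⋆ topQ-odd)
topQ-odd-equation zero    = refl
topQ-odd-equation (suc i) = begin
  topQ-odd (suc i)
    ≡⟨ coeff-Q-odd i (suc (suc i)) ⟩
  sumUpTo (suc i) evens + sumUpTo i odds
    ≡⟨ cong₂ _+_ (sumUpTo-zero (suc i) evens≡0) (sumUpTo-cong i odds≡) ⟩
  sumUpTo i (λ k → topQ-odd (i ∸ k) * topQ-odd k)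
    ≡⟨ ⋆-swapped i topQ-odd topQ-odd ⟩
  (topQ-odd ⋆ topQ-odd) i
    ≡⟨ z⋆-suc (topQ-odd ⋆ topQ-odd) i ⟨
  (z ⋆ (topQ-odd ⋆ topQ-odd)) (suc i) ∎
  where
  open ≡-Reasoning
  evens odds : ℕ → ℕ
  evens k = coeff (Q (double (suc i ∸ k)) ⊗ P (double k)) (suc (suc i))
  odds  k = coeff (Q (suc (double (i ∸ k))) ⊗ P (suc (double k))) (suc (suc i))
  evens≡0 : ∀ k → k ≤ suc i → evens k ≡ 0
  evens≡0 k k≤1+i = vanishes (DegreeBelow-⊗ (degree-Q-even (suc i ∸ k)) (degree-P-even k))
    (suc (suc i)) (≤-reflexive (∸+suc≡suc k≤1+i))
  odds≡ : ∀ k → k ≤ i → odds k ≡ topQ-odd (i ∸ k) * topQ-odd k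
  odds≡ k k≤i = trans (coeff-⊗-top (cong suc (∸+suc≡suc k≤i)) (degree-Q-odd (i ∸ k)) (degree-P-odd k))
    (cong (topQ-odd (i ∸ k) *_) (topP-odd≗topQ-odd k))

topP-even-equation : topP-even ≗ z ⋆ topQ-odd ⊞ topQ-even
topP-even-equation zero    = refl
topP-even-equation (suc i) = begin
  topP-even (suc i)                                               ≡⟨ coeff-P-suc-suc (double i) (suc i) ⟩
  coeff (shift (P (suc (double i)))) (suc i) + topQ-even (suc i)  ≡⟨ cong (_+ topQ-even (suc i)) top ⟩
  (z ⋆ topQ-odd) (suc i) + topQ-even (suc i)                      ∎
  where
  open ≡-Reasoning
  top : coeff (shift (P (suc (double i)))) (suc i) ≡ (z ⋆ topQ-odd) (suc i)
  top = trans (coeff-shift-top (degree-P-odd i)) (trans (topP-odd≗topQ-odd i) (sym (z⋆-suc topQ-odd i)))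

topQ-even-equation : topQ-even ≗ z ⋆ (topP-even ⋆ topQ-odd ⊞ topQ-odd ⋆ topQ-even)
topQ-even-equation zero    = refl
topQ-even-equation (suc i) = begin
  topQ-even (suc i)
    ≡⟨ coeff-Q-even i (suc i) ⟩
  sumUpTo i evens + sumUpTo i odds
    ≡⟨ cong₂ _+_ (sumUpTo-cong i evens≡) (sumUpTo-cong i odds≡) ⟩
  sumUpTo i (λ k → topQ-odd (i ∸ k) * topP-even k) + sumUpTo i (λ k → topQ-even (i ∸ k) * topQ-odd k)
    ≡⟨ cong₂ _+_ (⋆-swapped i topP-even topQ-odd) (⋆-swapped i topQ-odd topQ-even) ⟩
  (topP-even ⋆ topQ-odd ⊞ topQ-odd ⋆ topQ-even) i
    ≡⟨ z⋆-suc (topP-even ⋆ topQ-odd ⊞ topQ-odd ⋆ topQ-even) i ⟨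
  (z ⋆ (topP-even ⋆ topQ-odd ⊞ topQ-odd ⋆ topQ-even)) (suc i) ∎
  where
  open ≡-Reasoning
  evens odds : ℕ → ℕ
  evens k = coeff (Q (suc (double (i ∸ k))) ⊗ P (double k)) (suc i)
  odds  k = coeff (Q (double (i ∸ k)) ⊗ P (suc (double k))) (suc i)
  evens≡ : ∀ k → k ≤ i → evens k ≡ topQ-odd (i ∸ k) * topP-even k
  evens≡ k k≤i = coeff-⊗-top (cong suc (m∸n+n≡m k≤i)) (degree-Q-odd (i ∸ k)) (degree-P-even k)
  odds≡ : ∀ k → k ≤ i → odds k ≡ topQ-even (i ∸ k) * topQ-odd k
  odds≡ k k≤i = trans (coeff-⊗-top (∸+suc≡suc k≤i) (degree-Q-even (i ∸ k)) (degree-P-odd k))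
    (cong (topQ-even (i ∸ k) *_) (topP-odd≗topQ-odd k))

nextQ-odd-equation : nextQ-odd ≗ topP-even ⋆ topQ-even ⊞ z ⋆ (topQ-odd ⋆ nextQ-odd ⊞ nextP-odd ⋆ topQ-odd)
nextQ-odd-equation zero    = refl
nextQ-odd-equation (suc i) = begin
  nextQ-odd (suc i)
    ≡⟨ coeff-Q-odd i (suc i) ⟩
  sumUpTo (suc i) evens + sumUpTo i odds
    ≡⟨ cong₂ _+_ (sumUpTo-cong (suc i) evens≡) (trans (sumUpTo-cong i odds≡) (sumUpTo-+ i _ _)) ⟩
  sumUpTo (suc i) (λ k → topQ-even (suc i ∸ k) * topP-even k) +
  (sumUpTo i (λ k → nextQ-odd (i ∸ k) * topQ-odd k) + sumUpTo i (λ k → topQ-odd (i ∸ k) * nextP-odd k))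
    ≡⟨ cong₂ _+_ (⋆-swapped (suc i) topP-even topQ-even)
                 (cong₂ _+_ (⋆-swapped i topQ-odd nextQ-odd) (⋆-swapped i nextP-odd topQ-odd)) ⟩
  (topP-even ⋆ topQ-even) (suc i) + (topQ-odd ⋆ nextQ-odd ⊞ nextP-odd ⋆ topQ-odd) i
    ≡⟨ cong ((topP-even ⋆ topQ-even) (suc i) +_) (z⋆-suc (topQ-odd ⋆ nextQ-odd ⊞ nextP-odd ⋆ topQ-odd) i) ⟨
  (topP-even ⋆ topQ-even) (suc i) + (z ⋆ (topQ-odd ⋆ nextQ-odd ⊞ nextP-odd ⋆ topQ-odd)) (suc i) ∎
  where
  open ≡-Reasoning
  evens odds : ℕ → ℕ
  evens k = coeff (Q (double (suc i ∸ k)) ⊗ P (double k)) (suc i)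
  odds  k = coeff (Q (suc (double (i ∸ k))) ⊗ P (suc (double k))) (suc i)
  evens≡ : ∀ k → k ≤ suc i → evens k ≡ topQ-even (suc i ∸ k) * topP-even k
  evens≡ k k≤1+i = coeff-⊗-top (m∸n+n≡m k≤1+i) (degree-Q-even (suc i ∸ k)) (degree-P-even k)
  odds≡ : ∀ k → k ≤ i → odds k ≡ nextQ-odd (i ∸ k) * topQ-odd k + topQ-odd (i ∸ k) * nextP-odd k
  odds≡ k k≤i = trans (coeff-⊗-subtop (cong suc (m∸n+n≡m k≤i)) (degree-Q-odd (i ∸ k)) (degree-P-odd k))
    (cong (λ c → nextQ-odd (i ∸ k) * c + topQ-odd (i ∸ k) * nextP-odd k) (topP-odd≗topQ-odd k))

nextP-odd-equation : nextP-odd ≗ topP-even ⊞ nextQ-odd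
nextP-odd-equation zero    = refl
nextP-odd-equation (suc i) = trans (coeff-P-suc-suc (suc (double i)) (suc i))
  (cong (_+ nextQ-odd (suc i)) (coeff-shift-top (degree-P-even (suc i))))

-- Central binomial coefficients

binomial : ℕ → ℕ → ℕ
binomial zero    zero    = 1
binomial zero    (suc k) = 0
binomial (suc n) zero    = 1
binomial (suc n) (suc k) = binomial n k + binomial n (suc k)

binomial≡C : ∀ n k → binomial n k ≡ n C k
binomial≡C zero    zero    = refl
binomial≡C zero    (suc k) = sym (k>n⇒nCk≡0 {0} {suc k} (s≤s z≤n))
binomial≡C (suc n) zero    = refl
binomial≡C (suc n) (suc k) =
  trans (cong₂ _+_ (binomial≡C n k) (binomial≡C n (suc k))) (nCk+nC[k+1]≡[n+1]C[k+1] n k)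

binomial-1 : ∀ n → binomial (suc n) 1 ≡ suc n
binomial-1 zero    = refl
binomial-1 (suc n) = cong suc (binomial-1 n)

binomial-absorb : ∀ n k → suc k * binomial (suc n) (suc k) ≡ suc n * binomial n k
binomial-absorb zero    zero    = refl
binomial-absorb zero    (suc k) = *-zeroʳ (suc (suc k))
binomial-absorb (suc n) zero    rewrite binomial-1 n =
  trans (+-identityʳ _) (sym (*-identityʳ (suc (suc n))))
binomial-absorb (suc n) (suc k) = begin
  suc (suc k) * (binomial (suc n) (suc k) + binomial (suc n) (suc (suc k)))
    ≡⟨ *-distribˡ-+ (suc (suc k)) (binomial (suc n) (suc k)) _ ⟩
  (binomial (suc n) (suc k) + suc k * binomial (suc n) (suc k)) + suc (suc k) * binomial (suc n) (suc (suc k))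
    ≡⟨ cong₂ (λ a b → (binomial (suc n) (suc k) + a) + b) (binomial-absorb n k) (binomial-absorb n (suc k)) ⟩
  (binomial (suc n) (suc k) + suc n * binomial n k) + suc n * binomial n (suc k)
    ≡⟨ +-assoc (binomial (suc n) (suc k)) _ _ ⟩
  binomial (suc n) (suc k) + (suc n * binomial n k + suc n * binomial n (suc k))
    ≡⟨ cong (binomial (suc n) (suc k) +_) (*-distribˡ-+ (suc n) (binomial n k) _) ⟨
  binomial (suc n) (suc k) + suc n * binomial (suc n) (suc k)
    ∎
  where open ≡-Reasoning

central : ℕ → ℕ
central n = binomial (double n) n

central-suc : ∀ n → suc n * central (suc n) ≡ 2 * (suc (double n) * central n)
central-suc n = begin
  suc n * binomial (suc (suc (double n))) (suc n)
    ≡⟨ binomial-absorb (suc (double n)) n ⟩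
  suc (suc (double n)) * binomial (suc (double n)) n
    ≡⟨ cong (suc (suc (double n)) *_) symmetric ⟩
  double (suc n) * binomial (suc (double n)) (suc n)
    ≡⟨ cong (_* binomial (suc (double n)) (suc n)) (double≡2* (suc n)) ⟩
  2 * suc n * binomial (suc (double n)) (suc n)
    ≡⟨ *-assoc 2 (suc n) _ ⟩
  2 * (suc n * binomial (suc (double n)) (suc n))
    ≡⟨ cong (2 *_) (binomial-absorb (double n) n) ⟩
  2 * (suc (double n) * central n) ∎
  where
  open ≡-Reasoning
  complement : suc (double n) ∸ n ≡ suc n
  complement = trans (cong (λ m → suc m ∸ n) (double≡+ n)) (m+n∸n≡m (suc n) n)
  symmetric : binomial (suc (double n)) n ≡ binomial (suc (double n)) (suc n)
  symmetric = begin
    binomial (suc (double n)) n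
      ≡⟨ binomial≡C (suc (double n)) n ⟩
    suc (double n) C n
      ≡⟨ nCk≡nC[n∸k] (m≤n⇒m≤1+n (subst (n ≤_) (sym (double≡+ n)) (m≤m+n n n))) ⟩
    suc (double n) C (suc (double n) ∸ n)
      ≡⟨ cong (suc (double n) C_) complement ⟩
    suc (double n) C suc n
      ≡⟨ binomial≡C (suc (double n)) (suc n) ⟨
    binomial (suc (double n)) (suc n) ∎

*-sumUpTo-symmetric : ∀ n (f : ℕ → ℕ) → (∀ k → k ≤ n → f (n ∸ k) ≡ f k) →
  n * sumUpTo n f ≡ 2 * sumUpTo n (λ k → (n ∸ k) * f k)
*-sumUpTo-symmetric n f symmetric = begin
  n * sumUpTo n f                                          ≡⟨ sumUpTo-*ˡ n n f ⟨
  sumUpTo n (λ k → n * f k)                                ≡⟨ sumUpTo-cong n split ⟩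
  sumUpTo n (λ k → k * f k + (n ∸ k) * f k)                ≡⟨ sumUpTo-+ n _ _ ⟩
  sumUpTo n (λ k → k * f k) + weighted                     ≡⟨ cong (_+ weighted) reflected ⟩
  weighted + weighted                                      ≡⟨ cong (weighted +_) (+-identityʳ weighted) ⟨
  2 * weighted                                             ∎
  where
  open ≡-Reasoning
  weighted : ℕ
  weighted = sumUpTo n (λ k → (n ∸ k) * f k)
  split : ∀ k → k ≤ n → n * f k ≡ k * f k + (n ∸ k) * f k
  split k k≤n = trans (cong (_* f k) (sym (m+[n∸m]≡n k≤n))) (*-distribʳ-+ (f k) k (n ∸ k))
  reflected : sumUpTo n (λ k → k * f k) ≡ weighted
  reflected = trans (sumUpTo-reflect n (λ k → k * f k))
    (sumUpTo-cong n (λ k k≤n → cong ((n ∸ k) *_) (symmetric k k≤n)))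

convolution-term-symmetric : ∀ (f : Series) n k → k ≤ n → f (n ∸ k) * f (n ∸ (n ∸ k)) ≡ f k * f (n ∸ k)
convolution-term-symmetric f n k k≤n = trans (cong (λ m → f (n ∸ k) * f m) (m∸[m∸n]≡n k≤n)) (*-comm (f (n ∸ k)) (f k))

central⋆central : ∀ n → (central ⋆ central) n ≡ 4 ^ n
central⋆central zero    = refl
central⋆central (suc n) = trans (*-cancelˡ-≡ _ _ (suc n) weighted-recurrence) (cong (4 *_) (central⋆central n))
  where
  open ≡-Reasoning
  S : ℕ → ℕ
  S = central ⋆ central
  term : ℕ → ℕ → ℕ
  term m k = central k * central (m ∸ k)

  step-term : ∀ k → k ≤ n → (suc n ∸ k) * term (suc n) k ≡ 2 * (term n k + 2 * ((n ∸ k) * term n k))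
  step-term k k≤n rewrite +-∸-assoc 1 k≤n = begin
    suc m * (central k * central (suc m))
      ≡⟨ x∙yz≈y∙xz (suc m) (central k) (central (suc m)) ⟩
    central k * (suc m * central (suc m))
      ≡⟨ cong (central k *_) (central-suc m) ⟩
    central k * (2 * (suc (double m) * central m))
      ≡⟨ cong (λ d → central k * (2 * (suc d * central m))) (double≡2* m) ⟩
    central k * (2 * ((1 + 2 * m) * central m))
      ≡⟨ arrange (central k) m (central m) ⟩
    2 * (central k * central m + 2 * (m * (central k * central m))) ∎
    where
    m = n ∸ k
    arrange : ∀ a m c → a * (2 * ((1 + 2 * m) * c)) ≡ 2 * (a * c + 2 * (m * (a * c)))
    arrange = solve-∀

  -- Weight the terms by n+1 = k + (n+1−k); use symmetry and (k+1) C(2k+2,k+1) = 2 (2k+1) C(2k,k).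
  weighted-recurrence : suc n * S (suc n) ≡ suc n * (4 * S n)
  weighted-recurrence = begin
    suc n * S (suc n)
      ≡⟨ *-sumUpTo-symmetric (suc n) (term (suc n)) (convolution-term-symmetric central (suc n)) ⟩
    2 * (sumUpTo n (λ k → (suc n ∸ k) * term (suc n) k) + (suc n ∸ suc n) * term (suc n) (suc n))
      ≡⟨ cong (λ d → 2 * (sumUpTo n (λ k → (suc n ∸ k) * term (suc n) k) + d * term (suc n) (suc n))) (n∸n≡0 n) ⟩
    2 * (sumUpTo n (λ k → (suc n ∸ k) * term (suc n) k) + 0)
      ≡⟨ cong (2 *_) (+-identityʳ (sumUpTo n (λ k → (suc n ∸ k) * term (suc n) k))) ⟩
    2 * sumUpTo n (λ k → (suc n ∸ k) * term (suc n) k)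
      ≡⟨ cong (2 *_) (sumUpTo-cong n step-term) ⟩
    2 * sumUpTo n (λ k → 2 * (term n k + 2 * ((n ∸ k) * term n k)))
      ≡⟨ cong (2 *_) (trans (sumUpTo-*ˡ n 2 _) (cong (2 *_) (sumUpTo-+ n (term n) _))) ⟩
    2 * (2 * (S n + sumUpTo n (λ k → 2 * ((n ∸ k) * term n k))))
      ≡⟨ cong (λ s → 2 * (2 * (S n + s))) (sumUpTo-*ˡ n 2 _) ⟩
    2 * (2 * (S n + 2 * sumUpTo n (λ k → (n ∸ k) * term n k)))
      ≡⟨ cong (λ s → 2 * (2 * (S n + s))) (*-sumUpTo-symmetric n (term n) (convolution-term-symmetric central n)) ⟨
    2 * (2 * (S n + n * S n))
      ≡⟨ arrange n (S n) ⟩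
    suc n * (4 * S n)
      ∎
    where
    arrange : ∀ n s → 2 * (2 * (s + n * s)) ≡ (1 + n) * (4 * s)
    arrange = solve-∀

-- Solving the system

open SemiringSolver seriesSemiring using (solve; _:=_; _:+_; _:*_; con)
module ≗-Reasoning = SetoidReasoning (CommutativeSemiring.setoid seriesSemiring)

invSqrt1m4z-squared : invSqrt1m4z ⋆ invSqrt1m4z ≗ inv1m4z
invSqrt1m4z-squared n = trans (⋆-cong invSqrt1m4z≡central invSqrt1m4z≡central n) (central⋆central n)
  where
  invSqrt1m4z≡central : ∀ k → invSqrt1m4z k ≡ central k
  invSqrt1m4z≡central k = trans (cong (_C k) (sym (double≡2* k))) (sym (binomial≡C (double k) k))

invSqrt1m4z-squared-equation : let b = invSqrt1m4z in b ⋆ b ≗ 𝟙 ⊞ z ⋆ (b ⋆ b ⊞ b ⋆ b ⊞ b ⋆ b ⊞ b ⋆ b)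
invSqrt1m4z-squared-equation zero    = refl
invSqrt1m4z-squared-equation (suc n) = begin
  (b ⋆ b) (suc n)                                   ≡⟨ invSqrt1m4z-squared (suc n) ⟩
  4 * 4 ^ n                                         ≡⟨ four-times (4 ^ n) ⟩
  4 ^ n + 4 ^ n + 4 ^ n + 4 ^ n                     ≡⟨ cong (λ x → x + x + x + x) (invSqrt1m4z-squared n) ⟨
  (b ⋆ b ⊞ b ⋆ b ⊞ b ⋆ b ⊞ b ⋆ b) n                 ≡⟨ z⋆-suc (b ⋆ b ⊞ b ⋆ b ⊞ b ⋆ b ⊞ b ⋆ b) n ⟨
  (z ⋆ (b ⋆ b ⊞ b ⋆ b ⊞ b ⋆ b ⊞ b ⋆ b)) (suc n)     ∎
  where
  open ≡-Reasoning
  b = invSqrt1m4z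
  four-times : ∀ x → 4 * x ≡ x + x + x + x
  four-times = solve-∀

invSqrt1m4z-equation : ∀ {c} → c ≗ 𝟙 ⊞ z ⋆ (c ⋆ c) →
  invSqrt1m4z ≗ 𝟙 ⊞ z ⋆ ((c ⊞ c) ⋆ invSqrt1m4z)
invSqrt1m4z-equation {c} c-equation =
  -- b and 1 + B both solve (X − B)² = 1, written without subtraction
  quadratic-unique (B ⋆ B) 𝟙 (B ⊞ B) refl refl refl b-equation 1+B-equation
  where
  open ≗-Reasoning
  b = invSqrt1m4z
  B = z ⋆ ((c ⊞ c) ⋆ b)
  T = z ⋆ (b ⋆ b ⊞ b ⋆ b ⊞ b ⋆ b ⊞ b ⋆ b)

  b-equation : b ⋆ b ⊞ B ⋆ B ≗ 𝟙 ⊞ b ⋆ (B ⊞ B)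
  b-equation = ⊞-cancelʳ T (begin
    b ⋆ b ⊞ B ⋆ B ⊞ T               ≈⟨ expand b c z ⟩
    b ⋆ b ⊞ T ⋆ (𝟙 ⊞ z ⋆ (c ⋆ c))   ≈⟨ ⊞-congˡ (b ⋆ b) (⋆-congˡ T (≗-sym c-equation)) ⟩
    b ⋆ b ⊞ T ⋆ c                   ≈⟨ regroup b c z ⟩
    b ⋆ b ⊞ b ⋆ (B ⊞ B)             ≈⟨ ⊞-congʳ (b ⋆ (B ⊞ B)) invSqrt1m4z-squared-equation ⟩
    𝟙 ⊞ T ⊞ b ⋆ (B ⊞ B)             ≈⟨ swap (b ⋆ (B ⊞ B)) T ⟩
    𝟙 ⊞ b ⋆ (B ⊞ B) ⊞ T             ∎)
    where
    expand : ∀ b c z →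
      b ⋆ b ⊞ (z ⋆ ((c ⊞ c) ⋆ b)) ⋆ (z ⋆ ((c ⊞ c) ⋆ b)) ⊞ z ⋆ (b ⋆ b ⊞ b ⋆ b ⊞ b ⋆ b ⊞ b ⋆ b) ≗
      b ⋆ b ⊞ (z ⋆ (b ⋆ b ⊞ b ⋆ b ⊞ b ⋆ b ⊞ b ⋆ b)) ⋆ (𝟙 ⊞ z ⋆ (c ⋆ c))
    expand = solve 3 (λ b c z →
      b :* b :+ (z :* ((c :+ c) :* b)) :* (z :* ((c :+ c) :* b))
        :+ z :* (b :* b :+ b :* b :+ b :* b :+ b :* b) :=
      b :* b :+ (z :* (b :* b :+ b :* b :+ b :* b :+ b :* b)) :* (con 1 :+ z :* (c :* c))) ≗-refl
    regroup : ∀ b c z →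
      b ⋆ b ⊞ (z ⋆ (b ⋆ b ⊞ b ⋆ b ⊞ b ⋆ b ⊞ b ⋆ b)) ⋆ c ≗
      b ⋆ b ⊞ b ⋆ (z ⋆ ((c ⊞ c) ⋆ b) ⊞ z ⋆ ((c ⊞ c) ⋆ b))
    regroup = solve 3 (λ b c z →
      b :* b :+ (z :* (b :* b :+ b :* b :+ b :* b :+ b :* b)) :* c :=
      b :* b :+ b :* (z :* ((c :+ c) :* b) :+ z :* ((c :+ c) :* b))) ≗-refl
    swap : ∀ x t → 𝟙 ⊞ t ⊞ x ≗ 𝟙 ⊞ x ⊞ t
    swap = solve 2 (λ x t → con 1 :+ t :+ x := con 1 :+ x :+ t) ≗-refl

  1+B-equation : (𝟙 ⊞ B) ⋆ (𝟙 ⊞ B) ⊞ B ⋆ B ≗ 𝟙 ⊞ (𝟙 ⊞ B) ⋆ (B ⊞ B)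
  1+B-equation = solve 1 (λ x → (con 1 :+ x) :* (con 1 :+ x) :+ x :* x := con 1 :+ (con 1 :+ x) :* (x :+ x))
    ≗-refl B

leading-even-solution : ∀ {c u w} →
  c ≗ 𝟙 ⊞ z ⋆ (c ⋆ c) → w ≗ z ⋆ c ⊞ u → u ≗ z ⋆ (w ⋆ c ⊞ c ⋆ u) → w ≗ z ⋆ invSqrt1m4z
leading-even-solution {c} {u} {w} c-equation w-equation u-equation =
  linear-unique (z ⋆ z ⋆ c ⋆ c) (z ⋆ c) (c ⊞ c) w-fixpoint zb-fixpoint
  where
  open ≗-Reasoning
  b = invSqrt1m4z

  w-fixpoint : w ⊞ z ⋆ z ⋆ c ⋆ c ≗ z ⋆ c ⊞ z ⋆ ((c ⊞ c) ⋆ w)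
  w-fixpoint = begin
    w ⊞ z ⋆ z ⋆ c ⋆ c
      ≈⟨ ⊞-congʳ (z ⋆ z ⋆ c ⋆ c) w-equation ⟩
    z ⋆ c ⊞ u ⊞ z ⋆ z ⋆ c ⋆ c
      ≈⟨ ⊞-congʳ (z ⋆ z ⋆ c ⋆ c) (⊞-congˡ (z ⋆ c) u-equation) ⟩
    z ⋆ c ⊞ z ⋆ (w ⋆ c ⊞ c ⋆ u) ⊞ z ⋆ z ⋆ c ⋆ c
      ≈⟨ regroup w u c z ⟩
    z ⋆ c ⊞ z ⋆ c ⋆ (w ⊞ (z ⋆ c ⊞ u))
      ≈⟨ ⊞-congˡ (z ⋆ c) (⋆-congˡ (z ⋆ c) (⊞-congˡ w (≗-sym w-equation))) ⟩
    z ⋆ c ⊞ z ⋆ c ⋆ (w ⊞ w)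
      ≈⟨ collect w c z ⟩
    z ⋆ c ⊞ z ⋆ ((c ⊞ c) ⋆ w) ∎
    where
    regroup : ∀ w u c z →
      z ⋆ c ⊞ z ⋆ (w ⋆ c ⊞ c ⋆ u) ⊞ z ⋆ z ⋆ c ⋆ c ≗ z ⋆ c ⊞ z ⋆ c ⋆ (w ⊞ (z ⋆ c ⊞ u))
    regroup = solve 4 (λ w u c z →
      z :* c :+ z :* (w :* c :+ c :* u) :+ z :* z :* c :* c := z :* c :+ z :* c :* (w :+ (z :* c :+ u))) ≗-refl
    collect : ∀ w c z → z ⋆ c ⊞ z ⋆ c ⋆ (w ⊞ w) ≗ z ⋆ c ⊞ z ⋆ ((c ⊞ c) ⋆ w)
    collect = solve 3 (λ w c z → z :* c :+ z :* c :* (w :+ w) := z :* c :+ z :* ((c :+ c) :* w)) ≗-refl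

  zb-fixpoint : z ⋆ b ⊞ z ⋆ z ⋆ c ⋆ c ≗ z ⋆ c ⊞ z ⋆ ((c ⊞ c) ⋆ (z ⋆ b))
  zb-fixpoint = begin
    z ⋆ b ⊞ z ⋆ z ⋆ c ⋆ c
      ≈⟨ ⊞-congʳ (z ⋆ z ⋆ c ⋆ c) (⋆-congˡ z (invSqrt1m4z-equation c-equation)) ⟩
    z ⋆ (𝟙 ⊞ z ⋆ ((c ⊞ c) ⋆ b)) ⊞ z ⋆ z ⋆ c ⋆ c
      ≈⟨ regroup b c z ⟩
    z ⋆ (𝟙 ⊞ z ⋆ (c ⋆ c)) ⊞ z ⋆ ((c ⊞ c) ⋆ (z ⋆ b))
      ≈⟨ ⊞-congʳ (z ⋆ ((c ⊞ c) ⋆ (z ⋆ b))) (⋆-congˡ z (≗-sym c-equation)) ⟩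
    z ⋆ c ⊞ z ⋆ ((c ⊞ c) ⋆ (z ⋆ b)) ∎
    where
    regroup : ∀ b c z →
      z ⋆ (𝟙 ⊞ z ⋆ ((c ⊞ c) ⋆ b)) ⊞ z ⋆ z ⋆ c ⋆ c ≗ z ⋆ (𝟙 ⊞ z ⋆ (c ⋆ c)) ⊞ z ⋆ ((c ⊞ c) ⋆ (z ⋆ b))
    regroup = solve 3 (λ b c z →
      z :* (con 1 :+ z :* ((c :+ c) :* b)) :+ z :* z :* c :* c :=
      z :* (con 1 :+ z :* (c :* c)) :+ z :* ((c :+ c) :* (z :* b))) ≗-refl

subleading-odd-solution : ∀ {c u w v y} →
  c ≗ 𝟙 ⊞ z ⋆ (c ⋆ c) → w ≗ z ⋆ c ⊞ u → v ≗ w ⋆ u ⊞ z ⋆ (c ⋆ v ⊞ y ⋆ c) → y ≗ w ⊞ v →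
  w ≗ z ⋆ invSqrt1m4z → v ≗ z ⋆ z ⋆ invSqrt1m4z ⋆ invSqrt1m4z ⋆ invSqrt1m4z
subleading-odd-solution {c} {u} {w} {v} {y} c-equation w-equation v-equation y-equation w-solution =
  linear-unique 𝟘 (w ⋆ w) (c ⊞ c) v-fixpoint zzbbb-fixpoint
  where
  open ≗-Reasoning
  b = invSqrt1m4z

  v-fixpoint : v ⊞ 𝟘 ≗ w ⋆ w ⊞ z ⋆ ((c ⊞ c) ⋆ v)
  v-fixpoint = begin
    v ⊞ 𝟘
      ≈⟨ (λ n → +-identityʳ (v n)) ⟩
    v
      ≈⟨ v-equation ⟩
    w ⋆ u ⊞ z ⋆ (c ⋆ v ⊞ y ⋆ c)
      ≈⟨ ⊞-congˡ (w ⋆ u) (⋆-congˡ z (⊞-congˡ (c ⋆ v) (⋆-congʳ c y-equation))) ⟩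
    w ⋆ u ⊞ z ⋆ (c ⋆ v ⊞ (w ⊞ v) ⋆ c)
      ≈⟨ regroup w u v c z ⟩
    w ⋆ (z ⋆ c ⊞ u) ⊞ z ⋆ ((c ⊞ c) ⋆ v)
      ≈⟨ ⊞-congʳ (z ⋆ ((c ⊞ c) ⋆ v)) (⋆-congˡ w (≗-sym w-equation)) ⟩
    w ⋆ w ⊞ z ⋆ ((c ⊞ c) ⋆ v) ∎
    where
    regroup : ∀ w u v c z → w ⋆ u ⊞ z ⋆ (c ⋆ v ⊞ (w ⊞ v) ⋆ c) ≗ w ⋆ (z ⋆ c ⊞ u) ⊞ z ⋆ ((c ⊞ c) ⋆ v)
    regroup = solve 5 (λ w u v c z →
      w :* u :+ z :* (c :* v :+ (w :+ v) :* c) := w :* (z :* c :+ u) :+ z :* ((c :+ c) :* v)) ≗-refl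

  zzbbb-fixpoint : z ⋆ z ⋆ b ⋆ b ⋆ b ⊞ 𝟘 ≗ w ⋆ w ⊞ z ⋆ ((c ⊞ c) ⋆ (z ⋆ z ⋆ b ⋆ b ⋆ b))
  zzbbb-fixpoint = begin
    z ⋆ z ⋆ b ⋆ b ⋆ b ⊞ 𝟘
      ≈⟨ (λ n → +-identityʳ ((z ⋆ z ⋆ b ⋆ b ⋆ b) n)) ⟩
    z ⋆ z ⋆ b ⋆ b ⋆ b
      ≈⟨ ⋆-congˡ (z ⋆ z ⋆ b ⋆ b) (invSqrt1m4z-equation c-equation) ⟩
    z ⋆ z ⋆ b ⋆ b ⋆ (𝟙 ⊞ z ⋆ ((c ⊞ c) ⋆ b))
      ≈⟨ regroup b c z ⟩
    (z ⋆ b) ⋆ (z ⋆ b) ⊞ z ⋆ ((c ⊞ c) ⋆ (z ⋆ z ⋆ b ⋆ b ⋆ b))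
      ≈⟨ ⊞-congʳ (z ⋆ ((c ⊞ c) ⋆ (z ⋆ z ⋆ b ⋆ b ⋆ b))) zb⋆zb≗w⋆w ⟩
    w ⋆ w ⊞ z ⋆ ((c ⊞ c) ⋆ (z ⋆ z ⋆ b ⋆ b ⋆ b)) ∎
    where
    zb⋆zb≗w⋆w : (z ⋆ b) ⋆ (z ⋆ b) ≗ w ⋆ w
    zb⋆zb≗w⋆w = ⋆-cong (≗-sym w-solution) (≗-sym w-solution)
    regroup : ∀ b c z →
      z ⋆ z ⋆ b ⋆ b ⋆ (𝟙 ⊞ z ⋆ ((c ⊞ c) ⋆ b)) ≗ (z ⋆ b) ⋆ (z ⋆ b) ⊞ z ⋆ ((c ⊞ c) ⋆ (z ⋆ z ⋆ b ⋆ b ⋆ b))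
    regroup = solve 3 (λ b c z →
      z :* z :* b :* b :* (con 1 :+ z :* ((c :+ c) :* b)) :=
      (z :* b) :* (z :* b) :+ z :* ((c :+ c) :* (z :* z :* b :* b :* b))) ≗-refl

rhsSeries≗z²b³ : rhsSeries ≗ z ⋆ z ⋆ invSqrt1m4z ⋆ invSqrt1m4z ⋆ invSqrt1m4z
rhsSeries≗z²b³ = begin
  zSquared ⋆ (inv1m4z ⋆ b)
    ≈⟨ ⋆-cong (≗-sym z⋆z≗zSquared) (⋆-congʳ b (≗-sym invSqrt1m4z-squared)) ⟩
  (z ⋆ z) ⋆ ((b ⋆ b) ⋆ b)
    ≈⟨ solve 2 (λ z b → (z :* z) :* ((b :* b) :* b) := z :* z :* b :* b :* b) ≗-refl z b ⟩
  z ⋆ z ⋆ b ⋆ b ⋆ b ∎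
  where
  open ≗-Reasoning
  b = invSqrt1m4z
  z⋆z≗zSquared : z ⋆ z ≗ zSquared
  z⋆z≗zSquared zero    = refl
  z⋆z≗zSquared (suc n) = trans (z⋆-suc z n) (shifted n)
    where
    shifted : ∀ n → z n ≡ zSquared (suc n)
    shifted zero          = refl
    shifted (suc zero)    = refl
    shifted (suc (suc n)) = refl

mainTheorem12 : (i : ℕ) → ψ̄ i ≡ rhsSeries i
mainTheorem12 i = begin
  ψ̄ i                                                    ≡⟨ cong (λ m → coeff (Q (suc m)) i) (double≡2* i) ⟨
  nextQ-odd i                                            ≡⟨ nextQ-odd-solution i ⟩
  (z ⋆ z ⋆ invSqrt1m4z ⋆ invSqrt1m4z ⋆ invSqrt1m4z) i    ≡⟨ rhsSeries≗z²b³ i ⟨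
  rhsSeries i                                            ∎
  where
  open ≡-Reasoning
  topP-even-solution : topP-even ≗ z ⋆ invSqrt1m4z
  topP-even-solution = leading-even-solution topQ-odd-equation topP-even-equation topQ-even-equation
  nextQ-odd-solution : nextQ-odd ≗ z ⋆ z ⋆ invSqrt1m4z ⋆ invSqrt1m4z ⋆ invSqrt1m4z
  nextQ-odd-solution = subleading-odd-solution
    topQ-odd-equation topP-even-equation nextQ-odd-equation nextP-odd-equation topP-even-solution
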